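{- Every contact$^-$ poset can be embedded into a contact$^-$ poset which is the order-reduct of a complete atomic Boolean algebra equipped with the overlap contact relation (i.e. $x\,\delta\, y$ iff $x\wedge y\neq 0$).
   Context: A poset here is a partially ordered set with a minimum element $0$. A contact$^-$ relation on a poset $(P,\leq)$ is a binary relation $\delta$ on $P$ such that for all $n,a,b,a_1,b_1\in P$: (Sym) $a\,\delta\, b \Leftrightarrow b\,\delta\, a$; (Emp) $a\,\delta\, b \Rightarrow a>0$ and $b>0$; (Ext) if $a\,\delta\, b$, $a\leq a_1$ and $b\leq b_1$ then $a_1\,\delta\, b_1$; (Ref) $n\neq 0\Rightarrow n\,\delta\, n$. A contact$^-$ poset is $(P,\leq,\delta)$ with $\delta$ a contact$^-$ relation on $(P,\leq)$. The overlap relation on a poset with $0$: $a\,\delta\, b$ iff there is $n>0$ with $n\leq a$ and $n\leq b$. An embedding of contact$^-$ posets is an injective, order-preserving, $0$-preserving map $\varphi$ with $a\,\delta\, b$ iff $\varphi(a)\,\delta\,\varphi(b)$ for all $a,b$ in the domain. -}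

module Defs where

open import Level using (Level; _⊔_; suc)
open import Data.Product using (Σ; ∃; _×_; _,_)
open import Relation.Nullary using (¬_)
open import Relation.Binary using (Rel)
open import Relation.Binary.Bundles using (Poset)
open import Relation.Unary using (Pred)
open import Algebra.Lattice.Bundles using (BooleanAlgebra)
open import Function.Bundles using (_⇔_)

-- Contact⁻ posets: a poset with a least element 0 and a relation δ
-- satisfying (Sym), (Emp), (Ext), (Ref).  For a poset with least
-- element 0, "a > 0" is "¬ (a ≈ 0)".

record ContactPoset (c ℓ₁ ℓ₂ ℓ₃ : Level) : Set (suc (c ⊔ ℓ₁ ⊔ ℓ₂ ⊔ ℓ₃)) where
  field
    poset : Poset c ℓ₁ ℓ₂
  open Poset poset public
  field
    𝟘     : Carrier
    𝟘-min : ∀ a → 𝟘 ≤ a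
    _δ_   : Rel Carrier ℓ₃
    sym-δ : ∀ {a b} → a δ b → b δ a
    emp   : ∀ {a b} → a δ b → ¬ (a ≈ 𝟘) × ¬ (b ≈ 𝟘)
    ext   : ∀ {a b a₁ b₁} → a δ b → a ≤ a₁ → b ≤ b₁ → a₁ δ b₁
    ref   : ∀ {n} → ¬ (n ≈ 𝟘) → n δ n

module _ {b ℓ : Level} (B : BooleanAlgebra b ℓ) where
  open BooleanAlgebra B hiding (¬_)

  _≤ᴮ_ : Rel Carrier ℓ
  x ≤ᴮ y = (x ∧ y) ≈ x

  Overlap : Rel Carrier ℓ
  Overlap x y = ¬ ((x ∧ y) ≈ ⊥)

  IsLub : ∀ {ℓS} → Pred Carrier ℓS → Carrier → Set (b ⊔ ℓ ⊔ ℓS)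
  IsLub S s = (∀ x → S x → x ≤ᴮ s)
            × (∀ u → (∀ x → S x → x ≤ᴮ u) → s ≤ᴮ u)

  IsComplete : Set (suc b ⊔ ℓ)
  IsComplete = (S : Pred Carrier b) → ∃ λ s → IsLub S s

  IsAtom : Carrier → Set (b ⊔ ℓ)
  IsAtom a = ¬ (a ≈ ⊥) × (∀ y → y ≤ᴮ a → ¬ (y ≈ ⊥) → y ≈ a)

  IsAtomic : Set (b ⊔ ℓ)
  IsAtomic = ∀ x → ¬ (x ≈ ⊥) → ∃ λ a → IsAtom a × a ≤ᴮ x

module _ {c ℓ₁ ℓ₂ ℓ₃ b ℓ : Level}
         (P : ContactPoset c ℓ₁ ℓ₂ ℓ₃) (B : BooleanAlgebra b ℓ) where
  private
    module P = ContactPoset P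
    module B = BooleanAlgebra B

  IsOverlapEmbedding : (P.Carrier → B.Carrier) → Set (c ⊔ ℓ₁ ⊔ ℓ₂ ⊔ ℓ₃ ⊔ ℓ)
  IsOverlapEmbedding φ =
      (∀ {x y} → x P.≈ y → φ x B.≈ φ y)
    × (∀ {x y} → φ x B.≈ φ y → x P.≈ y)
    × (∀ {x y} → x P.≤ y → _≤ᴮ_ B (φ x) (φ y))
    × (φ P.𝟘 B.≈ B.⊥)
    × (∀ x y → (x P.δ y) ⇔ Overlap B (φ x) (φ y))

-- Represent x by the set φ x of contact pairs (a , b) with a ≤ x or b ≤ x, inside the
-- powerset of all contact pairs, which is complete and atomic classically.  If x δ y then
-- the pair (x , y) lies in φ x ∩ φ y; conversely a common pair (a , b) gives x δ y by Ext,
-- using Sym for a mixed pair and Ref on a or b when both components sit below the same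
-- element.  Injectivity uses the diagonal pair (x , x), a contact pair by Ref when x ≠ 0.
module Submission where

open import Defs
open import Level using (Level; _⊔_; Lift; lift; lower)
open import Data.Bool using (true; false; _∧_)
open import Data.Bool.Properties using (∨-∧-booleanAlgebra)
open import Data.Product using (Σ; ∃; _×_; _,_; proj₁; proj₂)
open import Data.Sum using (_⊎_; inj₁; inj₂; reduce)
open import Data.Empty using (⊥-elim)
open import Relation.Nullary using (does; yes; no; ¬_)
open import Relation.Binary.PropositionalEquality using (_≡_; refl; sym; trans; subst)
open import Relation.Unary using (Pred)
open import Function.Base using (_∘_)
open import Function.Bundles using (_⇔_; mk⇔)
open import Algebra.Lattice.Bundles using (BooleanAlgebra)
open import Axiom.ExcludedMiddle using (ExcludedMiddle)
import Algebra.Construct.Pointwise as Pointwise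

pointwiseBooleanAlgebra : ∀ {a b ℓ} → Set a → BooleanAlgebra b ℓ → BooleanAlgebra (a ⊔ b) (a ⊔ ℓ)
pointwiseBooleanAlgebra X B = record
  { Carrier = X → B.Carrier
  ; _≈_ = λ f g → ∀ x → f x B.≈ g x
  ; _∨_ = λ f g x → f x B.∨ g x
  ; _∧_ = λ f g x → f x B.∧ g x
  ; ¬_ = λ f x → B.¬ f x
  ; ⊤ = λ _ → B.⊤
  ; ⊥ = λ _ → B.⊥
  ; isBooleanAlgebra = record
    { isDistributiveLattice = record
      { isLattice = record
        { isEquivalence = Pointwise.isEquivalence X B.isEquivalence
        ; ∨-comm = λ f g x → B.∨-comm (f x) (g x)
        ; ∨-assoc = λ f g h x → B.∨-assoc (f x) (g x) (h x)
        ; ∨-cong = λ f≈g h≈k x → B.∨-cong (f≈g x) (h≈k x)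
        ; ∧-comm = λ f g x → B.∧-comm (f x) (g x)
        ; ∧-assoc = λ f g h x → B.∧-assoc (f x) (g x) (h x)
        ; ∧-cong = λ f≈g h≈k x → B.∧-cong (f≈g x) (h≈k x)
        ; absorptive = (λ f g x → B.∨-absorbs-∧ (f x) (g x))
                     , (λ f g x → B.∧-absorbs-∨ (f x) (g x))
        }
      ; ∨-distrib-∧ = (λ f g h x → B.∨-distribˡ-∧ (f x) (g x) (h x))
                    , (λ f g h x → B.∨-distribʳ-∧ (f x) (g x) (h x))
      ; ∧-distrib-∨ = (λ f g h x → B.∧-distribˡ-∨ (f x) (g x) (h x))
                    , (λ f g h x → B.∧-distribʳ-∨ (f x) (g x) (h x))
      }
    ; ∨-complement = (λ f x → B.∨-complementˡ (f x)) , (λ f x → B.∨-complementʳ (f x))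
    ; ∧-complement = (λ f x → B.∧-complementˡ (f x)) , (λ f x → B.∧-complementʳ (f x))
    ; ¬-cong = λ f≈g x → B.¬-cong (f≈g x)
    }
  }
  where module B = BooleanAlgebra B

true⇔true⇒≡ : ∀ {x y} → (x ≡ true → y ≡ true) → (y ≡ true → x ≡ true) → x ≡ y
true⇔true⇒≡ {false} {false} _ _ = refl
true⇔true⇒≡ {false} {true}  _ y⇒x with y⇒x refl
... | ()
true⇔true⇒≡ {true}  {false} x⇒y _ with x⇒y refl
... | ()
true⇔true⇒≡ {true}  {true}  _ _ = refl

∧-true⁺ : ∀ {x y} → x ≡ true → y ≡ true → x ∧ y ≡ true
∧-true⁺ refl refl = refl

∧-true⁻ : ∀ {x y} → x ∧ y ≡ true → x ≡ true × y ≡ true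
∧-true⁻ {true} {true} _ = refl , refl

module Powerset {a} (X : Set a) where

  𝒫 : BooleanAlgebra a a
  𝒫 = pointwiseBooleanAlgebra X ∨-∧-booleanAlgebra

  open BooleanAlgebra 𝒫 public using (Carrier; _≈_; ⊥)

  _∈_ : X → Carrier → Set
  p ∈ S = S p ≡ true

  _⊆_ : Carrier → Carrier → Set a
  S ⊆ S′ = ∀ p → p ∈ S → p ∈ S′

  ⊆-antisym : ∀ {S S′} → S ⊆ S′ → S′ ⊆ S → S ≈ S′
  ⊆-antisym S⊆S′ S′⊆S p = true⇔true⇒≡ (S⊆S′ p) (S′⊆S p)

  ≈⇒⊆ : ∀ {S S′} → S ≈ S′ → S ⊆ S′
  ≈⇒⊆ S≈S′ p p∈S = trans (sym (S≈S′ p)) p∈S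

  ⊆⇒≤ : ∀ {S S′} → S ⊆ S′ → _≤ᴮ_ 𝒫 S S′
  ⊆⇒≤ S⊆S′ p = true⇔true⇒≡ (proj₁ ∘ ∧-true⁻) (λ p∈S → ∧-true⁺ p∈S (S⊆S′ p p∈S))

  ≤⇒⊆ : ∀ {S S′} → _≤ᴮ_ 𝒫 S S′ → S ⊆ S′
  ≤⇒⊆ S≤S′ p p∈S = proj₂ (∧-true⁻ (trans (S≤S′ p) p∈S))

  no-member⇒≈⊥ : ∀ {S} → (∀ p → ¬ p ∈ S) → S ≈ ⊥
  no-member⇒≈⊥ empty = ⊆-antisym (λ p p∈S → ⊥-elim (empty p p∈S)) (λ _ ())

  member⇒≉⊥ : ∀ {S p} → p ∈ S → ¬ S ≈ ⊥
  member⇒≉⊥ {p = p} p∈S S≈⊥ with trans (sym (S≈⊥ p)) p∈S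
  ... | ()

  common-member⇒Overlap : ∀ {S S′ p} → p ∈ S → p ∈ S′ → Overlap 𝒫 S S′
  common-member⇒Overlap p∈S p∈S′ = member⇒≉⊥ (∧-true⁺ p∈S p∈S′)

module ClassicalPowerset {a} (em : ExcludedMiddle a) (X : Set a) where

  open Powerset X

  ⟦_⟧ : Pred X a → Carrier
  ⟦ A ⟧ p = does (em {A p})

  ⟦⟧⁺ : ∀ A {p} → A p → p ∈ ⟦ A ⟧
  ⟦⟧⁺ A {p} Ap with em {A p}
  ... | yes _ = refl
  ... | no ¬Ap = ⊥-elim (¬Ap Ap)

  ⟦⟧⁻ : ∀ A {p} → p ∈ ⟦ A ⟧ → A p
  ⟦⟧⁻ A {p} p∈A with em {A p}
  ... | yes Ap = Ap

  ≉⊥⇒member : ∀ {S} → ¬ S ≈ ⊥ → ∃ (_∈ S)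
  ≉⊥⇒member {S} S≉⊥ with em {∃ (_∈ S)}
  ... | yes member = member
  ... | no ¬member = ⊥-elim (S≉⊥ (no-member⇒≈⊥ λ p p∈S → ¬member (p , p∈S)))

  Overlap⇒common-member : ∀ {S S′} → Overlap 𝒫 S S′ → ∃ λ p → p ∈ S × p ∈ S′
  Overlap⇒common-member S⋈S′ =
    let p , p∈S∩S′ = ≉⊥⇒member S⋈S′ in p , ∧-true⁻ p∈S∩S′

  InSome : Pred Carrier a → Pred X a
  InSome 𝒮 p = ∃ λ S → 𝒮 S × p ∈ S

  ⋃ : Pred Carrier a → Carrier
  ⋃ 𝒮 = ⟦ InSome 𝒮 ⟧

  ⋃-isLub : ∀ 𝒮 → IsLub 𝒫 𝒮 (⋃ 𝒮)
  ⋃-isLub 𝒮 = (λ S S∈𝒮 → ⊆⇒≤ λ p p∈S → ⟦⟧⁺ (InSome 𝒮) (S , S∈𝒮 , p∈S))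
            , (λ U U-upper → ⊆⇒≤ λ p p∈⋃ → let S , S∈𝒮 , p∈S = ⟦⟧⁻ (InSome 𝒮) p∈⋃ in
                                            ≤⇒⊆ (U-upper S S∈𝒮) p p∈S)

  𝒫-isComplete : IsComplete 𝒫
  𝒫-isComplete 𝒮 = ⋃ 𝒮 , ⋃-isLub 𝒮

  ｛_｝ : X → Carrier
  ｛ q ｝ = ⟦ (_≡ q) ⟧

  ∈｛｝⇒≡ : ∀ {p q} → p ∈ ｛ q ｝ → p ≡ q
  ∈｛｝⇒≡ {q = q} = ⟦⟧⁻ (_≡ q)

  ｛｝-isAtom : ∀ q → IsAtom 𝒫 ｛ q ｝
  ｛｝-isAtom q = member⇒≉⊥ (⟦⟧⁺ (_≡ q) refl) , below-atom
    where
    below-atom : ∀ S → _≤ᴮ_ 𝒫 S ｛ q ｝ → ¬ S ≈ ⊥ → S ≈ ｛ q ｝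
    below-atom S S≤q S≉⊥ =
      let p , p∈S = ≉⊥⇒member S≉⊥
          q∈S = subst (_∈ S) (∈｛｝⇒≡ (≤⇒⊆ S≤q p p∈S)) p∈S
      in ⊆-antisym (≤⇒⊆ S≤q) (λ _ p∈q → subst (_∈ S) (sym (∈｛｝⇒≡ p∈q)) q∈S)

  𝒫-isAtomic : IsAtomic 𝒫
  𝒫-isAtomic S S≉⊥ =
    let q , q∈S = ≉⊥⇒member S≉⊥
    in ｛ q ｝ , ｛｝-isAtom q , ⊆⇒≤ λ _ p∈q → subst (_∈ S) (sym (∈｛｝⇒≡ p∈q)) q∈S

module ContactPosetProperties {c ℓ₁ ℓ₂ ℓ₃} (P : ContactPoset c ℓ₁ ℓ₂ ℓ₃) where

  open ContactPoset P

  ≤𝟘⇒≈𝟘 : ∀ {a} → a ≤ 𝟘 → a ≈ 𝟘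
  ≤𝟘⇒≈𝟘 {a} a≤𝟘 = antisym a≤𝟘 (𝟘-min a)

  δ⇒≰𝟘 : ∀ {a b} → a δ b → ¬ (a ≤ 𝟘 ⊎ b ≤ 𝟘)
  δ⇒≰𝟘 aδb (inj₁ a≤𝟘) = proj₁ (emp aδb) (≤𝟘⇒≈𝟘 a≤𝟘)
  δ⇒≰𝟘 aδb (inj₂ b≤𝟘) = proj₂ (emp aδb) (≤𝟘⇒≈𝟘 b≤𝟘)

  δ-above-contact : ∀ {a b x y} → a δ b → a ≤ x ⊎ b ≤ x → a ≤ y ⊎ b ≤ y → x δ y
  δ-above-contact aδb (inj₁ a≤x) (inj₁ a≤y) = ext (ref (proj₁ (emp aδb))) a≤x a≤y
  δ-above-contact aδb (inj₁ a≤x) (inj₂ b≤y) = ext aδb a≤x b≤y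
  δ-above-contact aδb (inj₂ b≤x) (inj₁ a≤y) = ext (sym-δ aδb) b≤x a≤y
  δ-above-contact aδb (inj₂ b≤x) (inj₂ b≤y) = ext (ref (proj₂ (emp aδb))) b≤x b≤y

module ContactPairEmbedding {c ℓ₁ ℓ₂ ℓ₃} (P : ContactPoset c ℓ₁ ℓ₂ ℓ₃)
                            (em : ExcludedMiddle (c ⊔ ℓ₁ ⊔ ℓ₂ ⊔ ℓ₃)) where

  private module P = ContactPoset P
  open P using (_≤_; _δ_; 𝟘)
  open ContactPosetProperties P

  L : Level
  L = c ⊔ ℓ₁ ⊔ ℓ₂ ⊔ ℓ₃

  record ContactPair : Set L where
    constructor mkContactPair
    field
      left right : P.Carrier
      contact    : left δ right

  open ContactPair

  open Powerset ContactPair public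
  open ClassicalPowerset em ContactPair public

  Touches : P.Carrier → Pred ContactPair L
  Touches x π = Lift L (left π ≤ x ⊎ right π ≤ x)

  φ : P.Carrier → Carrier
  φ x = ⟦ Touches x ⟧

  ∈φ⁺ : ∀ x π → left π ≤ x ⊎ right π ≤ x → π ∈ φ x
  ∈φ⁺ x π touches = ⟦⟧⁺ (Touches x) {π} (lift touches)

  ∈φ⁻ : ∀ x π → π ∈ φ x → left π ≤ x ⊎ right π ≤ x
  ∈φ⁻ x π π∈φx = lower (⟦⟧⁻ (Touches x) {π} π∈φx)

  φ-mono : ∀ {x y} → x ≤ y → φ x ⊆ φ y
  φ-mono {x} {y} x≤y π π∈φx with ∈φ⁻ x π π∈φx
  ... | inj₁ l≤x = ∈φ⁺ y π (inj₁ (P.trans l≤x x≤y))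
  ... | inj₂ r≤x = ∈φ⁺ y π (inj₂ (P.trans r≤x x≤y))

  φ-cong : ∀ {x y} → x P.≈ y → φ x ≈ φ y
  φ-cong x≈y = ⊆-antisym (φ-mono (P.reflexive x≈y)) (φ-mono (P.reflexive (P.Eq.sym x≈y)))

  φ-𝟘 : φ 𝟘 ≈ ⊥
  φ-𝟘 = no-member⇒≈⊥ λ π π∈φ𝟘 → δ⇒≰𝟘 (contact π) (∈φ⁻ 𝟘 π π∈φ𝟘)

  φ-reflects-≤ : ∀ {x y} → φ x ⊆ φ y → x ≤ y
  φ-reflects-≤ {x} {y} φx⊆φy with em {Lift L (x P.≈ 𝟘)}
  ... | yes (lift x≈𝟘) = P.trans (P.reflexive x≈𝟘) (P.𝟘-min y)
  ... | no x≉𝟘 = reduce (∈φ⁻ y diagonal (φx⊆φy diagonal (∈φ⁺ x diagonal (inj₁ P.refl))))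
    where
    diagonal : ContactPair
    diagonal = mkContactPair x x (P.ref (x≉𝟘 ∘ lift))

  φ-injective : ∀ {x y} → φ x ≈ φ y → x P.≈ y
  φ-injective φx≈φy = P.antisym (φ-reflects-≤ (≈⇒⊆ φx≈φy))
                                (φ-reflects-≤ (≈⇒⊆ (λ π → sym (φx≈φy π))))

  δ⇔Overlap : ∀ x y → (x δ y) ⇔ Overlap 𝒫 (φ x) (φ y)
  δ⇔Overlap x y = mk⇔ to from
    where
    to : x δ y → Overlap 𝒫 (φ x) (φ y)
    to xδy = common-member⇒Overlap {φ x} {φ y} {π} (∈φ⁺ x π (inj₁ P.refl)) (∈φ⁺ y π (inj₂ P.refl))
      where π = mkContactPair x y xδy
    from : Overlap 𝒫 (φ x) (φ y) → x δ y
    from φx⋈φy with Overlap⇒common-member φx⋈φy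
    ... | π , π∈φx , π∈φy = δ-above-contact (contact π) (∈φ⁻ x π π∈φx) (∈φ⁻ y π π∈φy)

theorem4 : ∀ {c ℓ₁ ℓ₂ ℓ₃ : Level}
    → ExcludedMiddle (c ⊔ ℓ₁ ⊔ ℓ₂ ⊔ ℓ₃)
    → (P : ContactPoset c ℓ₁ ℓ₂ ℓ₃)
    → Σ (BooleanAlgebra (c ⊔ ℓ₁ ⊔ ℓ₂ ⊔ ℓ₃) (c ⊔ ℓ₁ ⊔ ℓ₂ ⊔ ℓ₃)) λ B →
    IsComplete B × IsAtomic B
    × ∃ λ φ → IsOverlapEmbedding P B φ
theorem4 em P = 𝒫 , 𝒫-isComplete , 𝒫-isAtomic
              , φ , φ-cong , φ-injective , ⊆⇒≤ ∘ φ-mono , φ-𝟘 , δ⇔Overlap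
  where open ContactPairEmbedding P em
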